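{- Let $N$ be a DC $X$-network that is a tree. Then every cluster-preserving simplification of $N$ is also a tree.
   Context: An $X$-network $N=(V,E,r,X)$ is a finite directed graph (no loops, no multiple arcs) that is acyclic, has a root $r$ (every vertex reachable from $r$ by a directed path), and whose leaves (out-degree $0$) are identified bijectively with $X$. The cluster of $v$ is $cl(v;N)=\{x\in X:\text{there is a directed path (possibly of length }0\text{) from } v\text{ to } x\}$; $N$ is distinct-cluster (DC) if distinct vertices have distinct clusters. $N$ is a tree if no vertex has more than one parent. An arc $(a,b)$ is redundant if there is a directed path from $a$ to $b$ of length greater than $1$. For a vertex $v\neq r$, $v\notin X$ with parents $q_1,\dots,q_k$ and children $c_1,\dots,c_m$, $D(v)N$ deletes $v$ and its incident arcs and adds arcs $(q_i,c_j)$ for all $i,j$ (no duplicates); for a redundant arc $(a,b)$, $D(a,b)N$ deletes that arc. A DC $X$-network $N'$ is a cluster-preserving simplification (CPS) of $N$ if there is a sequence $N=N_0,\dots,N_k=N'$ ($k\ge0$) of DC $X$-networks with each $N_{i+1}=D(v)N_i$ for a non-root non-leaf vertex $v$ of $N_i$ or $N_{i+1}=D(a,b)N_i$ for a redundant arc $(a,b)$ of $N_i$. -}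

module Defs where

open import Data.Nat using (ℕ; _≡ᵇ_)
open import Data.Bool using (Bool; true; false; if_then_else_; _∧_; not)
open import Data.List using (List; []; _∷_; [_]; filterᵇ; concatMap; _++_)
open import Data.List.Membership.Propositional using (_∈_)
open import Data.Product using (_×_; _,_; proj₁; proj₂; Σ; ∃)
open import Data.Sum using (_⊎_)
open import Data.Empty using (⊥)
open import Relation.Nullary using (¬_)
open import Relation.Binary.PropositionalEquality using (_≡_; _≢_)
open import Function.Bundles using (_⇔_)

-- The vertex set is the set of members of 'verts'; the arc set is the set
-- of members of 'arcs' (so repeated entries are irrelevant: no multiple arcs).
record Graph (X : Set) : Set where
  constructor graph
  field
    verts : List ℕ
    arcs  : List (ℕ × ℕ)
    root  : ℕ
    leaf  : X → ℕ
open Graph public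

module _ {X : Set} (G : Graph X) where

  Vertex : ℕ → Set
  Vertex v = v ∈ verts G

  Arc : ℕ → ℕ → Set
  Arc a b = (a , b) ∈ arcs G

  data Path : ℕ → ℕ → Set where
    here  : ∀ {a} → Path a a
    there : ∀ {a b c} → Arc a b → Path b c → Path a c

  Path⁺ : ℕ → ℕ → Set
  Path⁺ a c = Σ ℕ λ b → Arc a b × Path b c

  IsLeaf : ℕ → Set
  IsLeaf v = Vertex v × (∀ w → ¬ Arc v w)

  -- v ∈ X under the identification of leaves with X
  InX : ℕ → Set
  InX v = Σ X λ x → leaf G x ≡ v

  record IsXNetwork : Set where
    field
      arcs-in-verts : ∀ a b → Arc a b → Vertex a × Vertex b
      acyclic       : ∀ v → ¬ Path⁺ v v
      root-vertex   : Vertex (root G)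
      rooted        : ∀ v → Vertex v → Path (root G) v
      leaf-is-leaf  : ∀ x → IsLeaf (leaf G x)
      leaf-inj      : ∀ x y → leaf G x ≡ leaf G y → x ≡ y
      leaf-onto     : ∀ v → IsLeaf v → InX v

  cl : ℕ → X → Set
  cl v x = Path v (leaf G x)

  DistinctCluster : Set
  DistinctCluster = ∀ u v → Vertex u → Vertex v → u ≢ v →
                    ¬ (∀ x → cl u x ⇔ cl v x)

  DCNetwork : Set
  DCNetwork = IsXNetwork × DistinctCluster

  IsTree : Set
  IsTree = ∀ v p q → Arc p v → Arc q v → p ≡ q

  Redundant : ℕ → ℕ → Set
  Redundant a b = Arc a b × (Σ ℕ λ c → Arc a c × Path⁺ c b)

deleteVertex : {X : Set} → ℕ → Graph X → Graph X
deleteVertex v (graph vs as r l) =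
  graph (filterᵇ (λ u → not (u ≡ᵇ v)) vs)
        (filterᵇ (λ e → not (proj₁ e ≡ᵇ v) ∧ not (proj₂ e ≡ᵇ v)) as
          ++ concatMap (λ e₁ → concatMap (λ e₂ →
                if (proj₂ e₁ ≡ᵇ v) ∧ (proj₁ e₂ ≡ᵇ v)
                then [ (proj₁ e₁ , proj₂ e₂) ] else []) as) as)
        r l

deleteArc : {X : Set} → ℕ → ℕ → Graph X → Graph X
deleteArc a b (graph vs as r l) =
  graph vs (filterᵇ (λ e → not ((proj₁ e ≡ᵇ a) ∧ (proj₂ e ≡ᵇ b))) as) r l

-- one simplification step (without the DC requirement)
data Step {X : Set} (N : Graph X) : Graph X → Set where
  delV : ∀ v → Vertex N v → v ≢ root N → ¬ InX N v →
         Step N (deleteVertex v N)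
  delA : ∀ a b → Redundant N a b → Step N (deleteArc a b N)

-- N' is a cluster-preserving simplification of N:
-- a sequence N = N₀, …, N_k = N' of DC X-networks, consecutive ones related by Step
data CPS {X : Set} : Graph X → Graph X → Set where
  done : ∀ {N} → DCNetwork N → CPS N N
  step : ∀ {N M N'} → DCNetwork N → Step N M → CPS M N' → CPS N N'

-- Neither simplification step can give a vertex a second parent.  Deleting an
-- arc only removes parents.  Deleting a vertex w creates only arcs (q, c) with
-- q a parent and c a child of w; in a tree c had the single parent w, and w
-- had a single parent, so c again has exactly one parent.  Hence the tree
-- property passes along every sequence of steps, DC or not.
module Submission where

open import Defs
open import Data.Nat using (ℕ; _≡ᵇ_)
open import Data.Nat.Properties using (≡ᵇ⇒≡; ≡⇒≡ᵇ)
open import Data.Bool using (Bool; true; if_then_else_; _∧_; not; T)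
open import Data.Bool.Properties using (T-∧; T-not-≡)
open import Data.List using (List; []; [_]; filterᵇ; concatMap)
open import Data.List.Membership.Propositional using (_∈_; find)
open import Data.List.Membership.Propositional.Properties
  using (∈-filter⁻; ∈-++⁻; ∈-concatMap⁻)
open import Data.List.Relation.Unary.Any using (here)
open import Data.Product using (_×_; _,_; proj₁; ∃)
open import Data.Sum using (inj₁; inj₂)
open import Data.Empty using (⊥-elim)
open import Function.Bundles using (Equivalence)
open import Relation.Nullary.Decidable using (T?)
open import Relation.Binary.PropositionalEquality using (_≡_; _≢_; refl; subst)

∈-filterᵇ⁻ : {A : Set} (p : A → Bool) {xs : List A} {y : A} →
             y ∈ filterᵇ p xs → y ∈ xs × T (p y)
∈-filterᵇ⁻ p = ∈-filter⁻ (λ x → T? (p x))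

∈-concatMap⁻′ : {A B : Set} (f : A → List B) (xs : List A) {y : B} →
                y ∈ concatMap f xs → ∃ λ x → x ∈ xs × y ∈ f x
∈-concatMap⁻′ f xs y∈ = find (∈-concatMap⁻ f {xs = xs} y∈)

∈-if-singleton⁻ : {A : Set} (b : Bool) {e y : A} →
                  y ∈ (if b then [ e ] else []) → T b × y ≡ e
∈-if-singleton⁻ true (here refl) = _ , refl

T-not-≡ᵇ⇒≢ : ∀ {m n} → T (not (m ≡ᵇ n)) → m ≢ n
T-not-≡ᵇ⇒≢ {m} {n} t m≡n =
  subst T (Equivalence.to T-not-≡ t) (≡⇒≡ᵇ m n m≡n)

deleteArc-arc⁻ : {X : Set} (N : Graph X) (a b : ℕ) {p v : ℕ} →
                 Arc (deleteArc a b N) p v → Arc N p v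
deleteArc-arc⁻ N a b p→v = proj₁ (∈-filterᵇ⁻ _ p→v)

deleteArc-preserves-tree : {X : Set} (N : Graph X) (a b : ℕ) →
                           IsTree N → IsTree (deleteArc a b N)
deleteArc-preserves-tree N a b tree v p q p→v q→v =
  tree v p q (deleteArc-arc⁻ N a b p→v) (deleteArc-arc⁻ N a b q→v)

module _ {X : Set} (N : Graph X) (w : ℕ) where

  data DeleteVertexArc (p v : ℕ) : Set where
    kept     : Arc N p v → p ≢ w → DeleteVertexArc p v
    bypassed : Arc N p w → Arc N w v → DeleteVertexArc p v

  deleteVertex-arc⁻ : ∀ {p v} → Arc (deleteVertex w N) p v → DeleteVertexArc p v
  deleteVertex-arc⁻ {p} {v} p→v with ∈-++⁻ (filterᵇ _ (arcs N)) p→v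
  ... | inj₁ p→v∈kept =
    let p→v∈N , untouched = ∈-filterᵇ⁻ _ p→v∈kept
    in kept p→v∈N (T-not-≡ᵇ⇒≢ (proj₁ (Equivalence.to T-∧ untouched)))
  ... | inj₂ p→v∈new
    with (p₁ , v₁) , e₁∈N , ∈inner ← ∈-concatMap⁻′ _ (arcs N) p→v∈new
    with (p₂ , v₂) , e₂∈N , ∈if ← ∈-concatMap⁻′ _ (arcs N) ∈inner
    with meets , refl ← ∈-if-singleton⁻ ((v₁ ≡ᵇ w) ∧ (p₂ ≡ᵇ w)) ∈if
    with v₁≡w , p₂≡w ← Equivalence.to (T-∧ {v₁ ≡ᵇ w}) meets =
    bypassed (subst (Arc N p) (≡ᵇ⇒≡ v₁ w v₁≡w) e₁∈N)
             (subst (λ u → Arc N u v) (≡ᵇ⇒≡ p₂ w p₂≡w) e₂∈N)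

  deleteVertex-preserves-tree : IsTree N → IsTree (deleteVertex w N)
  deleteVertex-preserves-tree tree v p q p→v q→v
    with deleteVertex-arc⁻ p→v | deleteVertex-arc⁻ q→v
  ... | kept p→v′ _     | kept q→v′ _     = tree v p q p→v′ q→v′
  ... | kept p→v′ p≢w   | bypassed _ w→v  = ⊥-elim (p≢w (tree v p w p→v′ w→v))
  ... | bypassed _ w→v  | kept q→v′ q≢w   = ⊥-elim (q≢w (tree v q w q→v′ w→v))
  ... | bypassed p→w _  | bypassed q→w _  = tree w p q p→w q→w

Step-preserves-tree : {X : Set} {N M : Graph X} → Step N M → IsTree N → IsTree M
Step-preserves-tree {N = N} (delV v _ _ _) = deleteVertex-preserves-tree N v
Step-preserves-tree {N = N} (delA a b _)   = deleteArc-preserves-tree N a b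

CPS-preserves-tree : {X : Set} {N N' : Graph X} → CPS N N' → IsTree N → IsTree N'
CPS-preserves-tree (done _)       tree = tree
CPS-preserves-tree (step _ s cps) tree = CPS-preserves-tree cps (Step-preserves-tree s tree)

theorem5p3 : {X : Set} (N N' : Graph X) → DCNetwork N → IsTree N →
             CPS N N' → IsTree N'
theorem5p3 N N' _ tree cps = CPS-preserves-tree cps tree
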